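{- Let $S=\{C_1,\dots,C_n\}$ be a finite set of propositional clauses and let $\phi_1,\phi_2,\dots,\phi_t$ be a deduction sequence of contradiction separation based on standard extension from $S$ to $\phi_t$. If $\phi_t=\emptyset$ (the empty clause), then $S$ is unsatisfiable.
   Context: Propositional logic. A literal is a propositional variable or its negation; $p$ and $\neg p$ are complementary. A clause is a finite disjunction of literals, identified with the finite set of its literals; $\emptyset$ is the empty clause. Contradiction separation based on standard extension: let $m\ge2$, let $D_1,\dots,D_m$ be clauses (repetitions allowed) and $x_1,\dots,x_{m-1}$ literals, and suppose sub-clauses $D_i^-\subseteq D_i$ are chosen with $D_1^-=\{x_1\}$, $D_i^-=\{x_i,\neg x_{i-1}\}\cup D^i$ for $2\le i\le m-1$, $D_m^-=\{\neg x_{m-1}\}\cup D^m$, where $D^2=\emptyset$ and $D^j\subseteq\{\neg x_1,\dots,\neg x_{j-2}\}$ for $3\le j\le m$. Put $D_i^+=D_i\setminus D_i^-$. Then the clause $R_s(D_1,\dots,D_m)=\bigcup_{i=1}^m D_i^+$ is called a contradiction separation clause based on standard extension of $D_1,\dots,D_m$. A deduction sequence of contradiction separation based on standard extension from $S$ to $\phi_t$ is a finite sequence of clauses $\phi_1,\dots,\phi_t$ such that each $\phi_i$ either belongs to $S$, or there exist indices $r_1,\dots,r_{k_i}<i$ such that $\phi_i$ is a contradiction separation clause based on standard extension $R_s(\phi_{r_1},\dots,\phi_{r_{k_i}})$. -}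

module Defs where

open import Data.Nat using (ℕ; suc; _+_; _≤_; _<_)
open import Data.Bool using (Bool; true; false; not; T)
open import Data.Fin using (Fin; toℕ; fromℕ)
open import Data.List using (List)
open import Data.List.Membership.Propositional using (_∈_)
open import Data.List.Relation.Unary.All using (All)
open import Data.List.Relation.Unary.Any using (Any)
open import Data.Product using (Σ; ∃; _×_)
open import Data.Sum using (_⊎_)
open import Relation.Nullary using (¬_)
open import Relation.Binary.PropositionalEquality using (_≡_)
open import Function.Bundles using (_⇔_)

-- Propositional variables are natural numbers.
-- A literal is a variable with a polarity (true = positive, false = negated).
record Literal : Set where
  constructor lit
  field
    var : ℕ
    pos : Bool
open Literal public

neg : Literal → Literal
neg (lit v b) = lit v (not b)

-- A clause is a finite set of literals, represented by a list (read as the set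
-- of its members); the empty clause is [].
Clause : Set
Clause = List Literal

Assignment : Set
Assignment = ℕ → Bool

litTrue : Assignment → Literal → Set
litTrue v (lit x true)  = T (v x)
litTrue v (lit x false) = T (not (v x))

clauseTrue : Assignment → Clause → Set
clauseTrue v C = Any (litTrue v) C

Satisfiable : List Clause → Set
Satisfiable S = ∃ λ (v : Assignment) → All (clauseTrue v) S

Unsatisfiable : List Clause → Set
Unsatisfiable S = ¬ Satisfiable S

-- Contradiction separation based on standard extension, with m = 2 + k clauses.
-- 0-based indexing: clauses D 0 … D (m-1), literals x 0 … x (m-2),
-- extra sets E i (paper's D^{i+1}).
Minus : ∀ {k} → (Fin (suc k) → Literal) → (Fin (suc (suc k)) → Clause) →
        Fin (suc (suc k)) → Literal → Set
Minus {k} x E i l =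
    (∃ λ (a : Fin (suc k)) → toℕ a ≡ toℕ i × l ≡ x a)
  ⊎ (∃ λ (a : Fin (suc k)) → suc (toℕ a) ≡ toℕ i × l ≡ neg (x a))
  ⊎ l ∈ E i

record IsCSSE {k : ℕ} (D : Fin (suc (suc k)) → Clause) (R : Clause) : Set where
  field
    x : Fin (suc k) → Literal
    E : Fin (suc (suc k)) → Clause
    -- paper: D^2 = ∅ and D^j ⊆ {¬x_1,…,¬x_{j-2}} for 3 ≤ j ≤ m
    -- (0-based: E i ⊆ {¬ x a | a + 2 ≤ i}, which forces E 0 = E 1 = ∅)
    E-ok : ∀ i l → l ∈ E i → ∃ λ (a : Fin (suc k)) → toℕ a + 2 ≤ toℕ i × l ≡ neg (x a)
    minus-sub : ∀ i l → Minus x E i l → l ∈ D i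
    R-eq : ∀ l → (l ∈ R) ⇔ (∃ λ i → l ∈ D i × ¬ Minus x E i l)

DeductionSeq : ∀ {t} → List Clause → (Fin t → Clause) → Set
DeductionSeq {t} S φ =
  ∀ (i : Fin t) →
    (φ i ∈ S)
    ⊎ (∃ λ (k : ℕ) → Σ (Fin (suc (suc k)) → Fin t) λ r →
         (∀ j → toℕ (r j) < toℕ i) × IsCSSE (λ j → φ (r j)) (φ i))

-- Let v satisfy every premise D_i but falsify R = ⋃ (D_i \ D_i⁻). Then the true
-- literal of each D_i lies in D_i⁻. Inductively x_i is true: the true literal of
-- D_i cannot be ¬x_{i-1} nor any ¬x_a with a ≤ i-2, so it must be x_i. The last
-- premise D_m has no x-literal in D_m⁻, so its true literal is the negation of a
-- true x_a, which is absurd. Hence every separation step preserves truth, every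
-- clause of a deduction sequence holds in every model of S, and a model of S
-- would make the empty clause true. Truth of a clause is decidable, so arguing
-- by contradiction is constructively harmless.
module Submission where

open import Defs
open import Data.Bool using (true; false; T; not)
open import Data.Bool.Properties using (T?)
open import Data.Empty using (⊥)
open import Data.Fin using (Fin; fromℕ; toℕ; inject₁; _<_)
open import Data.Fin.Induction using (<-wellFounded)
open import Data.Fin.Properties using (toℕ-injective; toℕ-inject₁; toℕ-fromℕ; toℕ<n)
open import Data.List using (List; [])
open import Data.List.Membership.Propositional using (_∈_; find)
open import Data.List.Relation.Unary.All as All using (All)
open import Data.List.Relation.Unary.Any as Any using (any?)
open import Data.Nat using (ℕ; suc; _≤_; z<s)
open import Data.Nat.Properties using (≤-reflexive; ≤-trans; m<m+n; <-irrefl)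
open import Data.Product using (∃; _×_; _,_)
open import Data.Sum using (inj₁; inj₂)
open import Function.Bundles using (Equivalence)
open import Induction.WellFounded as WF using (WfRec)
open import Level using (0ℓ)
open import Relation.Nullary using (¬_; Stable)
open import Relation.Nullary.Decidable using (decidable-stable)
open import Relation.Nullary.Negation using (contradiction)
open import Relation.Unary using (Decidable)
open import Relation.Binary.PropositionalEquality using (_≡_; refl; trans; subst)

litTrue? : (v : Assignment) → Decidable (litTrue v)
litTrue? v (lit x true)  = T? (v x)
litTrue? v (lit x false) = T? (not (v x))

T-not : ∀ b → T b → ¬ T (not b)
T-not true  _ ()

litTrue⇒¬litTrue-neg : ∀ v l → litTrue v l → ¬ litTrue v (neg l)
litTrue⇒¬litTrue-neg v (lit x true)  p q = T-not (v x) p q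
litTrue⇒¬litTrue-neg v (lit x false) p q = T-not (v x) q p

litTrue-stable : ∀ v l → Stable (litTrue v l)
litTrue-stable v l = decidable-stable (litTrue? v l)

clauseTrue-stable : ∀ v C → Stable (clauseTrue v C)
clauseTrue-stable v C = decidable-stable (any? (litTrue? v) C)

module CSSE-Refutation {k : ℕ} (v : Assignment)
  {D : Fin (suc (suc k)) → Clause} {R : Clause} (csse : IsCSSE D R)
  (D-true : ∀ i → clauseTrue v (D i)) (R-false : ¬ clauseTrue v R) where
  open IsCSSE csse

  true-literal-∈-Minus : ∀ i {l} → l ∈ D i → litTrue v l → ¬ ¬ Minus x E i l
  true-literal-∈-Minus i {l} l∈Di l-true l∉Minus =
    R-false (Any.map (λ { refl → l-true }) (Equivalence.from (R-eq l) (i , l∈Di , l∉Minus)))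

  true-Minus-literal-is-x : ∀ i → (∀ b → suc (toℕ b) ≤ toℕ i → litTrue v (x b)) →
                            ∀ {l} → litTrue v l → Minus x E i l →
                            ∃ λ a → toℕ a ≡ toℕ i × l ≡ x a
  true-Minus-literal-is-x i earlier-true l-true (inj₁ l-is-x) = l-is-x
  true-Minus-literal-is-x i earlier-true l-true (inj₂ (inj₁ (b , b+1≡i , refl))) =
    contradiction l-true (litTrue⇒¬litTrue-neg v (x b) (earlier-true b (≤-reflexive b+1≡i)))
  true-Minus-literal-is-x i earlier-true l-true (inj₂ (inj₂ l∈Ei)) with E-ok i _ l∈Ei
  ... | b , b+2≤i , refl =
    contradiction l-true (litTrue⇒¬litTrue-neg v (x b) (earlier-true b (≤-trans (m<m+n (toℕ b) z<s) b+2≤i)))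

  some-x-true-at : ∀ i → (∀ b → suc (toℕ b) ≤ toℕ i → litTrue v (x b)) →
                   ¬ ¬ (∃ λ a → toℕ a ≡ toℕ i × litTrue v (x a))
  some-x-true-at i earlier-true no-x with find (D-true i)
  ... | l , l∈Di , l-true = true-literal-∈-Minus i l∈Di l-true λ l∈Minus →
    let a , a≡i , l≡xa = true-Minus-literal-is-x i earlier-true l-true l∈Minus
    in no-x (a , a≡i , subst (litTrue v) l≡xa l-true)

  x-true : ∀ a → litTrue v (x a)
  x-true = WF.All.wfRec <-wellFounded 0ℓ (λ a → litTrue v (x a)) step
    where
    step : ∀ a → WfRec _<_ (λ b → litTrue v (x b)) a → litTrue v (x a)
    step a below-true = litTrue-stable v (x a) λ xa-false →
      some-x-true-at (inject₁ a) earlier-true λ (b , b≡a , xb-true) →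
        xa-false (subst (λ c → litTrue v (x c)) (toℕ-injective (trans b≡a (toℕ-inject₁ a))) xb-true)
      where
      earlier-true : ∀ b → suc (toℕ b) ≤ toℕ (inject₁ a) → litTrue v (x b)
      earlier-true b b<a = below-true (subst (suc (toℕ b) ≤_) (toℕ-inject₁ a) b<a)

  absurd : ⊥
  absurd = some-x-true-at (fromℕ (suc k)) (λ b _ → x-true b) λ (a , a≡m , _) →
    <-irrefl (trans a≡m (toℕ-fromℕ (suc k))) (toℕ<n a)

csse-sound : ∀ {k} v {D : Fin (suc (suc k)) → Clause} {R} → IsCSSE D R →
             (∀ i → clauseTrue v (D i)) → clauseTrue v R
csse-sound v csse D-true =
  clauseTrue-stable v _ (CSSE-Refutation.absurd v csse D-true)

deduction-sound : ∀ {S t} {φ : Fin t → Clause} → DeductionSeq S φ →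
                  ∀ v → All (clauseTrue v) S → ∀ i → clauseTrue v (φ i)
deduction-sound {φ = φ} deduction v S-true =
  WF.All.wfRec <-wellFounded 0ℓ (λ i → clauseTrue v (φ i)) step
  where
  step : ∀ i → WfRec _<_ (λ j → clauseTrue v (φ j)) i → clauseTrue v (φ i)
  step i earlier-true with deduction i
  ... | inj₁ φi∈S                 = All.lookup S-true φi∈S
  ... | inj₂ (_ , r , r<i , csse) = csse-sound v csse (λ j → earlier-true (r<i j))

theorem4p2 : (S : List Clause) (t : ℕ) (φ : Fin (suc t) → Clause) →
    DeductionSeq S φ → φ (fromℕ t) ≡ [] → Unsatisfiable S
theorem4p2 S t φ deduction φt≡[] (v , S-true)
  with subst (clauseTrue v) φt≡[] (deduction-sound deduction v S-true (fromℕ t))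
... | ()
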